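{- Let $\mathcal{M}=(Q,r)$ be a matroid of rank $4$ and let $(X,Y)$ be a nonmodular pair of flats of $\mathcal{M}$. Then $\mathcal{M}$ admits a Dress–Lovász extension for $(X,Y)$ if and only if it admits an AK extension for $(X,Y)$ that is a matroid.
   Context: Write $AB=A\cup B$ and $r(A|B)=r(AB)-r(B)$. A flat is a set $F$ with $r(Fx)>r(F)$ for all $x\notin F$; flats $X,Y$ are modular if $r(X)+r(Y)=r(XY)+r(X\cap Y)$, nonmodular otherwise. An extension of $(Q,r)$ is a polymatroid (here: matroid) $(QZ,g)$ with $Q\cap Z=\emptyset$ and $g=r$ on subsets of $Q$. An AK extension for $(X,Y)$ is an extension $(QZ,g)$ with (AK1) $g(Z|X)=0$ and (AK2) $g(X'|Z)=g(X'|Y)$ for every $X'\subseteq X$. A Dress–Lovász extension of $\mathcal{M}$ for $(X,Y)$ is a matroid extension $(QZ,g)$ in which there is a flat $T\subseteq QZ$ with (DL1) $g(T|X)=0$ and (DL2) for every flat $X'\subseteq X$: $g(T|X')=0$ if and only if $g(Y|X')=g(Y|X)$. -}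

module Defs where

open import Data.Nat using (ℕ; _+_; _∸_; _≤_; _<_)
open import Data.Fin using (Fin)
open import Data.Fin.Subset using (Subset; _∪_; _∩_; _⊆_; _∈_; _∉_; ⁅_⁆; ⊥; ⊤; ∣_∣)
open import Data.Vec using (_++_)
open import Data.Product using (Σ; _×_)
open import Relation.Binary.PropositionalEquality using (_≡_)
open import Function.Bundles using (_⇔_)

record Matroid (n : ℕ) : Set where
  field
    rk          : Subset n → ℕ
    rk-bounded  : ∀ A → rk A ≤ ∣ A ∣
    rk-mono     : ∀ A B → A ⊆ B → rk A ≤ rk B
    rk-submod   : ∀ A B → rk (A ∪ B) + rk (A ∩ B) ≤ rk A + rk B
open Matroid public

condRk : ∀ {n} → Matroid n → Subset n → Subset n → ℕ
condRk M A B = rk M (A ∪ B) ∸ rk M B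

IsFlat : ∀ {n} → Matroid n → Subset n → Set
IsFlat M F = ∀ x → x ∉ F → rk M F < rk M (F ∪ ⁅ x ⁆)

Modular : ∀ {n} → Matroid n → Subset n → Subset n → Set
Modular M X Y = rk M X + rk M Y ≡ rk M (X ∪ Y) + rk M (X ∩ Y)

NonModular : ∀ {n} → Matroid n → Subset n → Subset n → Set
NonModular M X Y = Modular M X Y → Data.Empty.⊥
  where import Data.Empty

-- Ground set of an extension: QZ = Fin (n + m), Q = first n, Z = last m.
embQ : ∀ {n} m → Subset n → Subset (n + m)
embQ m A = A ++ ⊥

setZ : ∀ n m → Subset (n + m)
setZ n m = ⊥ {n} ++ ⊤ {m}

IsExtension : ∀ {n m} → Matroid n → Matroid (n + m) → Set
IsExtension {n} {m} M g = ∀ A → rk g (embQ m A) ≡ rk M A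

IsAK : ∀ {n m} → Matroid n → Matroid (n + m) → Subset n → Subset n → Set
IsAK {n} {m} M g X Y =
  IsExtension M g
  × condRk g (setZ n m) (embQ m X) ≡ 0
  × (∀ X' → X' ⊆ X → condRk g (embQ m X') (setZ n m) ≡ condRk g (embQ m X') (embQ m Y))

HasMatroidAK : ∀ {n} → Matroid n → Subset n → Subset n → Set
HasMatroidAK {n} M X Y = Σ ℕ λ m → Σ (Matroid (n + m)) λ g → IsAK M g X Y

IsDL : ∀ {n m} → Matroid n → Matroid (n + m) → Subset n → Subset n → Set
IsDL {n} {m} M g X Y =
  IsExtension M g
  × Σ (Subset (n + m)) λ T →
      IsFlat g T
      × condRk g T (embQ m X) ≡ 0
      × (∀ X' → X' ⊆ X → IsFlat M X' →
           (condRk g T (embQ m X') ≡ 0) ⇔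
           (condRk g (embQ m Y) (embQ m X') ≡ condRk g (embQ m Y) (embQ m X)))

HasDL : ∀ {n} → Matroid n → Subset n → Subset n → Set
HasDL {n} M X Y = Σ ℕ λ m → Σ (Matroid (n + m)) λ g → IsDL M g X Y

{-# OPTIONS --safe #-}
module Submission where

-- A matroid AK extension is a Dress–Lovász extension with T the closure of Z: by (AK1) and
-- the two instances X′ and X of (AK2), both sides of (DL2) say that r(X′ Z) = r(X′).
--
-- Conversely, as X and Y are flats and not modular, r(X) + r(Y) > r(XY) + r(X ∩ Y) and
-- r(X), r(Y) < r(XY) ≤ 4.  So either r(X) + r(Y) = r(XY) + 1, or X and Y are planes meeting
-- in at most a point.  In the first case put one new point z freely on the DL flat T: for
-- flats X′ ⊆ X submodularity leaves two possible values of r(X′ Y) - r(X′), and (DL2) says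
-- that the smaller one occurs exactly when z ∈ cl(X′), which is (AK2).  In the second case
-- an AK extension always exists: two new points spanning a line of X through X ∩ Y.
-- Both extensions have the form r(A ∪ B) = min(r(A) + |B|, H(A)) for a suitable "cap" H.

open import Defs
open import Data.Bool using (Bool; true; _∨_; _∧_)
open import Data.Bool.Properties using (T-≡)
open import Data.Fin using (Fin; zero; suc)
open import Data.Fin.Subset using (Subset; _∪_; _∩_; _⊆_; _∈_; ⁅_⁆; ⊥; ⊤; ∣_∣; inside; outside)
open import Data.Fin.Subset.Properties
  using (⊆⊤; p⊆p∪q; q⊆p∪q; p∩q⊆p; p∩q⊆q; x∈p∪q⁻; x∈p∩q⁺; x∈⁅x⁆; x∈⁅y⁆⇒x≡y; ⊆-refl; ⊆-trans; ⊆-min; _∈?_;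
         drop-∷-⊆; ∪-idem; ∩-idem; ∪-identityˡ; ∪-identityʳ; ∪-comm; ∩-comm;
         ∣⊥∣≡0; ∣⊤∣≡n; p⊆q⇒∣p∣≤∣q∣; ∣p∩q∣≤∣p∣)
open import Data.List using (List; []; _∷_)
open import Data.List.Base using (allFin)
open import Data.List.Membership.Propositional using () renaming (_∈_ to _∈ₗ_)
open import Data.List.Membership.Propositional.Properties using (∈-allFin)
open import Data.List.Relation.Unary.Any using (here; there)
open import Data.Nat using (ℕ; zero; suc; _+_; _∸_; _⊓_; _≤_; _<_; _≤?_; _≟_; s≤s)
open import Data.Nat.Properties
open import Algebra.Properties.CommutativeSemigroup +-commutativeSemigroup
  using (xy∙z≈xz∙y; x∙yz≈y∙xz; interchange)
open import Data.Product using (Σ-syntax; _×_; _,_)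
open import Data.Sum using (_⊎_; inj₁; inj₂; [_,_]′)
open import Data.Vec using ([]; _∷_; _++_; tabulate; take; drop; here; there)
open import Data.Vec.Properties
  using (lookup∘tabulate; []=⇒lookup; lookup⇒[]=; take-zipWith; drop-zipWith; take++drop≡id; zipWith-++)
open import Function using (id; _∘_)
open import Function.Bundles using (_⇔_; mk⇔; Equivalence)
import Function.Properties.Equivalence as ⇔
open import Level using (0ℓ)
import Relation.Binary.Reasoning.Setoid
open import Relation.Binary.PropositionalEquality
open import Relation.Nullary using (¬_; yes; no; contradiction)
open import Relation.Nullary.Decidable using (isYes; toWitness; fromWitness)

module ⇔-Reasoning = Relation.Binary.Reasoning.Setoid (⇔.⇔-setoid 0ℓ)

private
  variable
    N : ℕ
    A B C D F U V : Subset N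
    x : Fin N


+≡+⇒∸≡∸ : ∀ {m n p q} → m + q ≡ p + n → m ∸ n ≡ p ∸ q
+≡+⇒∸≡∸ {m} {n} {p} {q} eq = begin
  m ∸ n              ≡⟨ [m+n]∸[m+o]≡n∸o q m n ⟨
  (q + m) ∸ (q + n)  ≡⟨ cong₂ _∸_ (+-comm q m) (+-comm q n) ⟩
  (m + q) ∸ (n + q)  ≡⟨ cong₂ _∸_ eq (+-comm n q) ⟩
  (p + n) ∸ (q + n)  ≡⟨ cong₂ _∸_ (+-comm p n) (+-comm q n) ⟩
  (n + p) ∸ (n + q)  ≡⟨ [m+n]∸[m+o]≡n∸o n p q ⟩
  p ∸ q              ∎
  where open ≡-Reasoning

∸≡∸⇒+≡+ : ∀ {m n p q} → n ≤ m → q ≤ p → m ∸ n ≡ p ∸ q → m + q ≡ p + n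
∸≡∸⇒+≡+ {m} {n} {p} {q} n≤m q≤p eq = begin
  m + q              ≡⟨ cong (_+ q) (m∸n+n≡m n≤m) ⟨
  (m ∸ n + n) + q    ≡⟨ cong (λ t → t + n + q) eq ⟩
  (p ∸ q + n) + q    ≡⟨ xy∙z≈xz∙y (p ∸ q) n q ⟩
  (p ∸ q + q) + n    ≡⟨ cong (_+ n) (m∸n+n≡m q≤p) ⟩
  p + n              ∎
  where open ≡-Reasoning

⊓-+-⊓-glb : ∀ {x s S t T} → x ≤ s + t → x ≤ s + T → x ≤ S + t → x ≤ S + T → x ≤ s ⊓ S + t ⊓ T
⊓-+-⊓-glb {x} {s} {S} {t} {T} x≤st x≤sT x≤St x≤ST = begin
  x                                       ≤⟨ ⊓-glb (⊓-glb x≤st x≤sT) (⊓-glb x≤St x≤ST) ⟩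
  ((s + t) ⊓ (s + T)) ⊓ ((S + t) ⊓ (S + T))  ≡⟨ cong₂ _⊓_ (+-distribˡ-⊓ s t T) (+-distribˡ-⊓ S t T) ⟨
  (s + t ⊓ T) ⊓ (S + t ⊓ T)                ≡⟨ +-distribʳ-⊓ (t ⊓ T) s S ⟨
  s ⊓ S + t ⊓ T                            ∎
  where open ≤-Reasoning

⊆-∪ˡ : A ⊆ A ∪ B
⊆-∪ˡ = p⊆p∪q _

⊆-∪ʳ : B ⊆ A ∪ B
⊆-∪ʳ = q⊆p∪q _ _

∪-least : A ⊆ C → B ⊆ C → A ∪ B ⊆ C
∪-least {A = A} {B = B} A⊆C B⊆C x∈ = [ A⊆C , B⊆C ]′ (x∈p∪q⁻ A B x∈)

∪-mono-⊆ : A ⊆ C → B ⊆ D → A ∪ B ⊆ C ∪ D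
∪-mono-⊆ A⊆C B⊆D = ∪-least (⊆-trans A⊆C ⊆-∪ˡ) (⊆-trans B⊆D ⊆-∪ʳ)

∩-greatest : C ⊆ A → C ⊆ B → C ⊆ A ∩ B
∩-greatest C⊆A C⊆B x∈ = x∈p∩q⁺ (C⊆A x∈ , C⊆B x∈)

∩-⊆ˡ : A ∩ B ⊆ A
∩-⊆ˡ = p∩q⊆p _ _

∩-⊆ʳ : A ∩ B ⊆ B
∩-⊆ʳ = p∩q⊆q _ _

⁅x⁆⊆ : x ∈ A → ⁅ x ⁆ ⊆ A
⁅x⁆⊆ {x = x} {A = A} x∈A y∈⁅x⁆ = subst (_∈ A) (sym (x∈⁅y⁆⇒x≡y x y∈⁅x⁆)) x∈A

∈-tabulate⇔ : {f : Fin N → Bool} → x ∈ tabulate f ⇔ f x ≡ true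
∈-tabulate⇔ {x = x} {f = f} = mk⇔
  (λ x∈ → trans (sym (lookup∘tabulate f x)) ([]=⇒lookup x∈))
  (λ fx → lookup⇒[]= x _ (trans (lookup∘tabulate f x) fx))

take-++ : ∀ {n k} (A : Subset n) (B : Subset k) → take n (A ++ B) ≡ A
take-++ []      B = refl
take-++ (a ∷ A) B = cong (a ∷_) (take-++ A B)

drop-++ : ∀ {n k} (A : Subset n) (B : Subset k) → drop n (A ++ B) ≡ B
drop-++ []      B = refl
drop-++ (a ∷ A) B = drop-++ A B

take-∪ : ∀ n {k} (S T : Subset (n + k)) → take n (S ∪ T) ≡ take n S ∪ take n T
take-∪ n = take-zipWith _∨_

take-∩ : ∀ n {k} (S T : Subset (n + k)) → take n (S ∩ T) ≡ take n S ∩ take n T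
take-∩ n = take-zipWith _∧_

drop-∪ : ∀ n {k} (S T : Subset (n + k)) → drop n (S ∪ T) ≡ drop n S ∪ drop n T
drop-∪ n = drop-zipWith _∨_

drop-∩ : ∀ n {k} (S T : Subset (n + k)) → drop n (S ∩ T) ≡ drop n S ∩ drop n T
drop-∩ n = drop-zipWith _∧_

take-⊆ : ∀ n {k} {S T : Subset (n + k)} → S ⊆ T → take n S ⊆ take n T
take-⊆ (suc n) {S = _ ∷ _} {T = _ ∷ _} S⊆T {zero} here with S⊆T here
... | here = here
take-⊆ (suc n) {S = _ ∷ _} {T = _ ∷ _} S⊆T {suc x} (there x∈) = there (take-⊆ n (drop-∷-⊆ S⊆T) x∈)

drop-⊆ : ∀ n {k} {S T : Subset (n + k)} → S ⊆ T → drop n S ⊆ drop n T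
drop-⊆ zero    S⊆T = S⊆T
drop-⊆ (suc n) {S = _ ∷ _} {T = _ ∷ _} S⊆T = drop-⊆ n (drop-∷-⊆ S⊆T)

++-mono-⊆ : ∀ {n k} {A C : Subset n} {B D : Subset k} → A ⊆ C → B ⊆ D → A ++ B ⊆ C ++ D
++-mono-⊆ {A = []}    {C = []}    _   B⊆D x∈ = B⊆D x∈
++-mono-⊆ {A = _ ∷ _} {C = _ ∷ _} A⊆C B⊆D {zero} here with A⊆C here
... | here = here
++-mono-⊆ {A = _ ∷ _} {C = _ ∷ _} A⊆C B⊆D {suc x} (there x∈) = there (++-mono-⊆ (drop-∷-⊆ A⊆C) B⊆D x∈)

∣++∣ : ∀ {n k} (A : Subset n) (B : Subset k) → ∣ A ++ B ∣ ≡ ∣ A ∣ + ∣ B ∣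
∣++∣ []            B = refl
∣++∣ (inside ∷ A)  B = cong suc (∣++∣ A B)
∣++∣ (outside ∷ A) B = ∣++∣ A B

∣take∣+∣drop∣ : ∀ n {k} (S : Subset (n + k)) → ∣ take n S ∣ + ∣ drop n S ∣ ≡ ∣ S ∣
∣take∣+∣drop∣ n S = trans (sym (∣++∣ (take n S) (drop n S))) (cong ∣_∣ (take++drop≡id n S))

∣p∪q∣+∣p∩q∣≡∣p∣+∣q∣ : (A B : Subset N) → ∣ A ∪ B ∣ + ∣ A ∩ B ∣ ≡ ∣ A ∣ + ∣ B ∣
∣p∪q∣+∣p∩q∣≡∣p∣+∣q∣ []            []            = refl
∣p∪q∣+∣p∩q∣≡∣p∣+∣q∣ (inside ∷ A)  (inside ∷ B)  =
  cong suc (trans (+-suc _ _) (trans (cong suc (∣p∪q∣+∣p∩q∣≡∣p∣+∣q∣ A B)) (sym (+-suc _ _))))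
∣p∪q∣+∣p∩q∣≡∣p∣+∣q∣ (inside ∷ A)  (outside ∷ B) = cong suc (∣p∪q∣+∣p∩q∣≡∣p∣+∣q∣ A B)
∣p∪q∣+∣p∩q∣≡∣p∣+∣q∣ (outside ∷ A) (inside ∷ B)  =
  trans (cong suc (∣p∪q∣+∣p∩q∣≡∣p∣+∣q∣ A B)) (sym (+-suc _ _))
∣p∪q∣+∣p∩q∣≡∣p∣+∣q∣ (outside ∷ A) (outside ∷ B) = ∣p∪q∣+∣p∩q∣≡∣p∣+∣q∣ A B

embQ-∪ : ∀ {n} m (A B : Subset n) → embQ m (A ∪ B) ≡ embQ m A ∪ embQ m B
embQ-∪ m A B = sym (trans (zipWith-++ _∨_ A ⊥ B ⊥) (cong ((A ∪ B) ++_) (∪-idem ⊥)))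

embQ-∩ : ∀ {n} m (A B : Subset n) → embQ m (A ∩ B) ≡ embQ m A ∩ embQ m B
embQ-∩ m A B = sym (trans (zipWith-++ _∧_ A ⊥ B ⊥) (cong ((A ∩ B) ++_) (∩-idem ⊥)))

embQ-mono-⊆ : ∀ {n} m {A B : Subset n} → A ⊆ B → embQ m A ⊆ embQ m B
embQ-mono-⊆ m A⊆B = ++-mono-⊆ A⊆B ⊆-refl

embQ-∪-setZ : ∀ {n} m (A : Subset n) → embQ m A ∪ setZ n m ≡ A ++ ⊤
embQ-∪-setZ m A = trans (zipWith-++ _∨_ A ⊥ ⊥ ⊤) (cong₂ _++_ (∪-identityʳ A) (∪-identityˡ ⊤))

Submodular : (Subset N → ℕ) → Set
Submodular f = ∀ A B → f (A ∪ B) + f (A ∩ B) ≤ f A + f B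

MixedSubmodular : (f g : Subset N → ℕ) → Set
MixedSubmodular f g = ∀ A B → g (A ∪ B) + f (A ∩ B) ≤ f A + g B

_⊓ᶠ_ : (f g : Subset N → ℕ) → Subset N → ℕ
(f ⊓ᶠ g) A = f A ⊓ g A

module _ {f g : Subset N → ℕ} where

  mixedSubmodular-swap : MixedSubmodular f g → ∀ A B → g (A ∪ B) + f (A ∩ B) ≤ g A + f B
  mixedSubmodular-swap fg A B = begin
    g (A ∪ B) + f (A ∩ B)  ≡⟨ cong₂ _+_ (cong g (∪-comm A B)) (cong f (∩-comm A B)) ⟩
    g (B ∪ A) + f (B ∩ A)  ≤⟨ fg B A ⟩
    f B + g A              ≡⟨ +-comm (f B) (g A) ⟩
    g A + f B              ∎
    where open ≤-Reasoning

  ⊓-submodular : Submodular f → Submodular g → MixedSubmodular f g → Submodular (f ⊓ᶠ g)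
  ⊓-submodular ff gg fg A B = ⊓-+-⊓-glb {s = f A} {S = g A} {t = f B} {T = g B}
    (≤-trans (+-mono-≤ (m⊓n≤m f∪ g∪) (m⊓n≤m f∩ g∩)) (ff A B))
    (≤-trans (+-mono-≤ (m⊓n≤n f∪ g∪) (m⊓n≤m f∩ g∩)) (fg A B))
    (≤-trans (+-mono-≤ (m⊓n≤n f∪ g∪) (m⊓n≤m f∩ g∩)) (mixedSubmodular-swap fg A B))
    (≤-trans (+-mono-≤ (m⊓n≤n f∪ g∪) (m⊓n≤n f∩ g∩)) (gg A B))
    where
    f∪ = f (A ∪ B)
    g∪ = g (A ∪ B)
    f∩ = f (A ∩ B)
    g∩ = g (A ∩ B)

  ⊓-mixedSubmodularʳ : {h : Subset N → ℕ} → MixedSubmodular h f → MixedSubmodular h g →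
                       MixedSubmodular h (f ⊓ᶠ g)
  ⊓-mixedSubmodularʳ {h} hf hg A B = begin
    f (A ∪ B) ⊓ g (A ∪ B) + h (A ∩ B)  ≤⟨ ⊓-glb (≤-trans (+-monoˡ-≤ (h (A ∩ B)) (m⊓n≤m _ _)) (hf A B))
                                                 (≤-trans (+-monoˡ-≤ (h (A ∩ B)) (m⊓n≤n _ _)) (hg A B)) ⟩
    (h A + f B) ⊓ (h A + g B)          ≡⟨ +-distribˡ-⊓ (h A) (f B) (g B) ⟨
    h A + f B ⊓ g B                    ∎
    where open ≤-Reasoning

module RankProperties {N : ℕ} (M : Matroid N) where

  r : Subset N → ℕ
  r = rk M

  r-mono : A ⊆ B → r A ≤ r B
  r-mono = rk-mono M _ _

  r-submod-⊆ : C ⊆ A → C ⊆ B → D ⊆ A ∪ B → r D + r C ≤ r A + r B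
  r-submod-⊆ {A = A} {B = B} C⊆A C⊆B D⊆A∪B =
    ≤-trans (+-mono-≤ (r-mono D⊆A∪B) (r-mono (∩-greatest C⊆A C⊆B))) (rk-submod M A B)

  r-⊥ : r ⊥ ≡ 0
  r-⊥ = n≤0⇒n≡0 (≤-trans (rk-bounded M ⊥) (≤-reflexive (∣⊥∣≡0 N)))

  r-subadditive : r (A ∪ B) ≤ r A + r B
  r-subadditive {A = A} {B = B} = begin
    r (A ∪ B)         ≡⟨ +-identityʳ _ ⟨
    r (A ∪ B) + 0     ≡⟨ cong (r (A ∪ B) +_) r-⊥ ⟨
    r (A ∪ B) + r ⊥   ≤⟨ r-submod-⊆ (⊆-min _) (⊆-min _) ⊆-refl ⟩
    r A + r B         ∎
    where open ≤-Reasoning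

  r-cross : U ⊆ V → r ((A ∪ B) ∪ V) + r ((A ∩ B) ∪ U) ≤ r (A ∪ U) + r (B ∪ V)
  r-cross U⊆V = r-submod-⊆
    (∪-mono-⊆ ∩-⊆ˡ ⊆-refl)
    (∪-least (⊆-trans ∩-⊆ʳ ⊆-∪ˡ) (⊆-trans U⊆V ⊆-∪ʳ))
    (∪-least (∪-mono-⊆ ⊆-∪ˡ ⊆-∪ˡ) (⊆-trans ⊆-∪ʳ ⊆-∪ʳ))

  r-cross₀ : r ((A ∪ B) ∪ U) + r (A ∩ B) ≤ r A + r (B ∪ U)
  r-cross₀ = r-submod-⊆ ∩-⊆ˡ (⊆-trans ∩-⊆ʳ ⊆-∪ˡ) (∪-least (∪-mono-⊆ ⊆-refl ⊆-∪ˡ) (⊆-trans ⊆-∪ʳ ⊆-∪ʳ))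

  r-∪-spanned : A ⊆ B → r B ≤ r A → r (B ∪ C) ≤ r (A ∪ C)
  r-∪-spanned {A = A} {B = B} {C = C} A⊆B rB≤rA = +-cancelˡ-≤ (r A) _ _ (begin
    r A + r (B ∪ C)        ≡⟨ +-comm (r A) _ ⟩
    r (B ∪ C) + r A        ≤⟨ r-submod-⊆ A⊆B ⊆-∪ˡ (∪-mono-⊆ ⊆-refl ⊆-∪ʳ) ⟩
    r B + r (A ∪ C)        ≤⟨ +-monoˡ-≤ (r (A ∪ C)) rB≤rA ⟩
    r A + r (A ∪ C)        ∎)
    where open ≤-Reasoning

  condRk≡0⇔ : condRk M A B ≡ 0 ⇔ r (A ∪ B) ≤ r B
  condRk≡0⇔ = mk⇔ m∸n≡0⇒m≤n m≤n⇒m∸n≡0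

  module _ (A S : Subset N) (spanned : ∀ {x} → x ∈ S → r (A ∪ ⁅ x ⁆) ≤ r A) where

    private
      grow : (xs : List (Fin N)) →
             Σ[ W ∈ Subset N ] A ⊆ W × r W ≤ r A × (∀ {y} → y ∈ S → y ∈ₗ xs → y ∈ W)
      grow [] = A , id , ≤-refl , λ _ ()
      grow (x ∷ xs) with grow xs | x ∈? S
      ... | W , A⊆W , rW≤rA , covers | no x∉S =
        W , A⊆W , rW≤rA , λ { y∈S (here refl) → contradiction y∈S x∉S
                             ; y∈S (there y∈xs) → covers y∈S y∈xs }
      ... | W , A⊆W , rW≤rA , covers | yes x∈S =
        ⁅ x ⁆ ∪ W , ⊆-trans A⊆W ⊆-∪ʳ , rW′≤rA , λ { _ (here refl) → ⊆-∪ˡ (x∈⁅x⁆ x)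
                                                   ; y∈S (there y∈xs) → ⊆-∪ʳ (covers y∈S y∈xs) }
        where
        rW′≤rA : r (⁅ x ⁆ ∪ W) ≤ r A
        rW′≤rA = +-cancelʳ-≤ (r A) _ _ (begin
          r (⁅ x ⁆ ∪ W) + r A      ≤⟨ r-submod-⊆ A⊆W ⊆-∪ˡ (∪-least (⊆-trans ⊆-∪ʳ ⊆-∪ʳ) ⊆-∪ˡ) ⟩
          r W + r (A ∪ ⁅ x ⁆)      ≤⟨ +-mono-≤ rW≤rA (spanned x∈S) ⟩
          r A + r A                ∎)
          where open ≤-Reasoning

    pointwise-spanned⇒r-∪≤ : r (A ∪ S) ≤ r A
    pointwise-spanned⇒r-∪≤ with grow (allFin N)
    ... | W , A⊆W , rW≤rA , covers =
      ≤-trans (r-mono (∪-least A⊆W (λ y∈S → covers y∈S (∈-allFin _)))) rW≤rA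

  cl : Subset N → Subset N
  cl A = tabulate λ x → isYes (r (A ∪ ⁅ x ⁆) ≤? r A)

  ∈cl⇔ : x ∈ cl A ⇔ r (A ∪ ⁅ x ⁆) ≤ r A
  ∈cl⇔ = ⇔.trans ∈-tabulate⇔ (⇔.trans (⇔.sym T-≡) (mk⇔ toWitness fromWitness))

  ⊆-cl : A ⊆ cl A
  ⊆-cl x∈A = Equivalence.from ∈cl⇔ (r-mono (∪-least ⊆-refl (⁅x⁆⊆ x∈A)))

  r-cl : r (cl A) ≡ r A
  r-cl {A = A} = ≤-antisym
    (≤-trans (r-mono ⊆-∪ʳ) (pointwise-spanned⇒r-∪≤ A (cl A) (Equivalence.to ∈cl⇔)))
    (r-mono ⊆-cl)

  r-cl-∪ : r (cl A ∪ B) ≡ r (A ∪ B)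
  r-cl-∪ = ≤-antisym (r-∪-spanned ⊆-cl (≤-reflexive r-cl)) (r-mono (∪-mono-⊆ ⊆-cl ⊆-refl))

  cl-isFlat : IsFlat M (cl A)
  cl-isFlat {A = A} x x∉cl = ≰⇒> λ r≤ → x∉cl (Equivalence.from ∈cl⇔ (begin
    r (A ∪ ⁅ x ⁆)       ≤⟨ r-mono (∪-mono-⊆ ⊆-cl ⊆-refl) ⟩
    r (cl A ∪ ⁅ x ⁆)    ≤⟨ r≤ ⟩
    r (cl A)            ≡⟨ r-cl ⟩
    r A                 ∎))
    where open ≤-Reasoning

  flat-⊇ : IsFlat M F → r (F ∪ A) ≤ r F → A ⊆ F
  flat-⊇ {F = F} flat r≤ {x} x∈A with x ∈? F
  ... | yes x∈F = x∈F
  ... | no x∉F = contradiction (≤-trans (r-mono (∪-mono-⊆ ⊆-refl (⁅x⁆⊆ x∈A))) r≤) (<⇒≱ (flat x x∉F))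

  cl-least : IsFlat M F → A ⊆ F → cl A ⊆ F
  cl-least {F = F} {A = A} flat A⊆F = flat-⊇ flat (begin
    r (F ∪ cl A)   ≤⟨ r-mono (∪-least ⊆-∪ʳ ⊆-∪ˡ) ⟩
    r (cl A ∪ F)   ≡⟨ r-cl-∪ ⟩
    r (A ∪ F)      ≤⟨ r-mono (∪-least A⊆F ⊆-refl) ⟩
    r F            ∎)
    where open ≤-Reasoning

  r-∪-comm : r (A ∪ B) ≡ r (B ∪ A)
  r-∪-comm {A = A} {B = B} = cong r (∪-comm A B)

  condRk-cong⇔ : condRk M A B ≡ condRk M A C ⇔ r (A ∪ B) + r C ≡ r (A ∪ C) + r B
  condRk-cong⇔ {A = A} {B = B} {C = C} = mk⇔
    (∸≡∸⇒+≡+ (r-mono ⊆-∪ʳ) (r-mono ⊆-∪ʳ))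
    (+≡+⇒∸≡∸ {r (A ∪ B)} {r B} {r (A ∪ C)} {r C})

  r-∪-shift-mixed : ∀ {c d} → U ⊆ V →
                    MixedSubmodular (λ A → r (A ∪ U) + c) (λ A → r (A ∪ V) + d)
  r-∪-shift-mixed {U = U} {V = V} {c} {d} U⊆V A B = begin
    (r ((A ∪ B) ∪ V) + d) + (r ((A ∩ B) ∪ U) + c)  ≡⟨ interchange (r ((A ∪ B) ∪ V)) d _ c ⟩
    (r ((A ∪ B) ∪ V) + r ((A ∩ B) ∪ U)) + (d + c)  ≤⟨ +-mono-≤ (r-cross U⊆V) (≤-reflexive (+-comm d c)) ⟩
    (r (A ∪ U) + r (B ∪ V)) + (c + d)              ≡⟨ interchange (r (A ∪ U)) (r (B ∪ V)) c d ⟩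
    (r (A ∪ U) + c) + (r (B ∪ V) + d)              ∎
    where open ≤-Reasoning

  ⊆⇒Modular : B ⊆ A → Modular M A B
  ⊆⇒Modular {B = B} {A = A} B⊆A = cong₂ _+_
    (≤-antisym (r-mono ⊆-∪ˡ) (r-mono (∪-least ⊆-refl B⊆A)))
    (≤-antisym (r-mono (∩-greatest B⊆A ⊆-refl)) (r-mono ∩-⊆ʳ))

  ⊇⇒Modular : A ⊆ B → Modular M A B
  ⊇⇒Modular {A = A} {B = B} A⊆B = begin
    r A + r B              ≡⟨ +-comm (r A) (r B) ⟩
    r B + r A              ≡⟨ cong₂ _+_ (≤-antisym (r-mono (∪-least A⊆B ⊆-refl)) (r-mono ⊆-∪ʳ))
                                        (≤-antisym (r-mono ∩-⊆ˡ) (r-mono (∩-greatest ⊆-refl A⊆B))) ⟨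
    r (A ∪ B) + r (A ∩ B)  ∎
    where open ≡-Reasoning

  NonModular⇒< : NonModular M A B → r (A ∪ B) + r (A ∩ B) < r A + r B
  NonModular⇒< {A = A} {B = B} nonmodular = ≤∧≢⇒< (rk-submod M A B) (nonmodular ∘ sym)

  flat-<-∪ : IsFlat M F → ¬ A ⊆ F → r F < r (F ∪ A)
  flat-<-∪ flat A⊈F = ≤∧≢⇒< (r-mono ⊆-∪ˡ) λ eq → A⊈F (flat-⊇ flat (≤-reflexive (sym eq)))

-- H A is the rank that A ⊆ Q is to reach together with all k new points: the extension
-- below gives A ∪ B (B new) the rank (r A + ∣ B ∣) ⊓ H A, and the fields of Cap are what
-- makes this a matroid.
record Cap {N : ℕ} (M : Matroid N) : Set where
  field
    cap        : Subset N → ℕ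
    cap-mono   : ∀ {A B} → A ⊆ B → cap A ≤ cap B
    cap-submod : Submodular cap
    cap-mixed  : MixedSubmodular (rk M) cap
    rk≤cap     : ∀ A → rk M A ≤ cap A

module _ {N : ℕ} {M : Matroid N} where
  open RankProperties M
  open Cap

  cap-cl : (H : Cap M) → cap H (cl A) ≡ cap H A
  cap-cl {A = A} H = ≤-antisym (+-cancelʳ-≤ (r A) _ _ (begin
    cap H (cl A) + r A               ≤⟨ +-mono-≤ (cap-mono H ⊆-∪ˡ) (r-mono (∩-greatest ⊆-cl ⊆-refl)) ⟩
    cap H (cl A ∪ A) + r (cl A ∩ A)  ≤⟨ cap-mixed H (cl A) A ⟩
    r (cl A) + cap H A               ≡⟨ cong (_+ cap H A) r-cl ⟩
    r A + cap H A                    ≡⟨ +-comm (r A) (cap H A) ⟩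
    cap H A + r A                    ∎)) (cap-mono H ⊆-cl)
    where open ≤-Reasoning

  Cap-⊓ : (H₁ H₂ : Cap M) → MixedSubmodular (cap H₁) (cap H₂) → Cap M
  Cap-⊓ H₁ H₂ mixed = record
    { cap        = cap H₁ ⊓ᶠ cap H₂
    ; cap-mono   = λ A⊆B → ⊓-mono-≤ (cap-mono H₁ A⊆B) (cap-mono H₂ A⊆B)
    ; cap-submod = ⊓-submodular {f = cap H₁} {g = cap H₂} (cap-submod H₁) (cap-submod H₂) mixed
    ; cap-mixed  = ⊓-mixedSubmodularʳ {f = cap H₁} {g = cap H₂} {h = rk M} (cap-mixed H₁) (cap-mixed H₂)
    ; rk≤cap     = λ A → ⊓-glb (rk≤cap H₁ A) (rk≤cap H₂ A)
    }

  rk-∪-cap : Subset N → ℕ → Cap M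
  rk-∪-cap U c = record
    { cap        = λ A → r (A ∪ U) + c
    ; cap-mono   = λ A⊆B → +-monoˡ-≤ c (r-mono (∪-mono-⊆ A⊆B ⊆-refl))
    ; cap-submod = r-∪-shift-mixed ⊆-refl
    ; cap-mixed  = mixed
    ; rk≤cap     = λ A → ≤-trans (r-mono ⊆-∪ˡ) (m≤m+n _ c)
    }
    where
    mixed : MixedSubmodular r (λ A → r (A ∪ U) + c)
    mixed A B = begin
      (r ((A ∪ B) ∪ U) + c) + r (A ∩ B)  ≡⟨ xy∙z≈xz∙y (r ((A ∪ B) ∪ U)) c (r (A ∩ B)) ⟩
      (r ((A ∪ B) ∪ U) + r (A ∩ B)) + c  ≤⟨ +-monoˡ-≤ c r-cross₀ ⟩
      (r A + r (B ∪ U)) + c              ≡⟨ +-assoc (r A) _ c ⟩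
      r A + (r (B ∪ U) + c)              ∎
      where open ≤-Reasoning

module _ {n m : ℕ} {M : Matroid n} (g : Matroid (n + m)) (ext : IsExtension M g) where
  private
    module G = RankProperties g

  rk-embQ-∪ : ∀ A B → rk g (embQ m A ∪ embQ m B) ≡ rk M (A ∪ B)
  rk-embQ-∪ A B = trans (cong (rk g) (sym (embQ-∪ m A B))) (ext (A ∪ B))

  rk-embQ-∩ : ∀ A B → rk g (embQ m A ∩ embQ m B) ≡ rk M (A ∩ B)
  rk-embQ-∩ A B = trans (cong (rk g) (sym (embQ-∩ m A B))) (ext (A ∩ B))

  extensionCap : Subset (n + m) → Cap M
  extensionCap T = record
    { cap        = capT
    ; cap-mono   = λ A⊆B → G.r-mono (∪-mono-⊆ (embQ-mono-⊆ m A⊆B) ⊆-refl)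
    ; cap-submod = submod
    ; cap-mixed  = mixed
    ; rk≤cap     = λ A → ≤-trans (≤-reflexive (sym (ext A))) (G.r-mono ⊆-∪ˡ)
    }
    where
    open ≤-Reasoning
    e : Subset n → Subset (n + m)
    e = embQ m
    capT : Subset n → ℕ
    capT A = rk g (e A ∪ T)

    submod : Submodular capT
    submod A B = begin
      capT (A ∪ B) + capT (A ∩ B)
        ≡⟨ cong₂ (λ S S′ → rk g (S ∪ T) + rk g (S′ ∪ T)) (embQ-∪ m A B) (embQ-∩ m A B) ⟩
      rk g ((e A ∪ e B) ∪ T) + rk g ((e A ∩ e B) ∪ T)
        ≤⟨ G.r-cross ⊆-refl ⟩
      capT A + capT B
        ∎

    mixed : MixedSubmodular (rk M) capT
    mixed A B = begin
      capT (A ∪ B) + rk M (A ∩ B)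
        ≡⟨ cong₂ _+_ (cong (λ S → rk g (S ∪ T)) (embQ-∪ m A B)) (sym (rk-embQ-∩ A B)) ⟩
      rk g ((e A ∪ e B) ∪ T) + rk g (e A ∩ e B)
        ≤⟨ G.r-cross₀ ⟩
      rk g (e A) + capT B
        ≡⟨ cong (_+ capT B) (ext A) ⟩
      rk M A + capT B
        ∎

module CapExtension {n : ℕ} {M : Matroid n} (H : Cap M) (k : ℕ) where
  open Cap H
  open RankProperties M

  free capped : Subset (n + k) → ℕ
  free S = r (take n S) + ∣ drop n S ∣
  capped S = cap (take n S)

  free-submod : Submodular free
  free-submod S T = begin
    free (S ∪ T) + free (S ∩ T)
      ≡⟨ cong₂ _+_ (cong₂ _+_ (cong r (take-∪ n S T)) (cong ∣_∣ (drop-∪ n S T)))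
                   (cong₂ _+_ (cong r (take-∩ n S T)) (cong ∣_∣ (drop-∩ n S T))) ⟩
    (r (A₁ ∪ A₂) + ∣ B₁ ∪ B₂ ∣) + (r (A₁ ∩ A₂) + ∣ B₁ ∩ B₂ ∣)
      ≡⟨ interchange (r (A₁ ∪ A₂)) _ _ _ ⟩
    (r (A₁ ∪ A₂) + r (A₁ ∩ A₂)) + (∣ B₁ ∪ B₂ ∣ + ∣ B₁ ∩ B₂ ∣)
      ≤⟨ +-mono-≤ (rk-submod M A₁ A₂) (≤-reflexive (∣p∪q∣+∣p∩q∣≡∣p∣+∣q∣ B₁ B₂)) ⟩
    (r A₁ + r A₂) + (∣ B₁ ∣ + ∣ B₂ ∣)
      ≡⟨ interchange (r A₁) _ _ _ ⟩
    free S + free T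
      ∎
    where
    open ≤-Reasoning
    A₁ = take n S
    A₂ = take n T
    B₁ = drop n S
    B₂ = drop n T

  capped-submod : Submodular capped
  capped-submod S T =
    subst₂ (λ U V → cap U + cap V ≤ capped S + capped T)
      (sym (take-∪ n S T)) (sym (take-∩ n S T)) (cap-submod (take n S) (take n T))

  free-capped-mixed : MixedSubmodular free capped
  free-capped-mixed S T = begin
    capped (S ∪ T) + free (S ∩ T)
      ≡⟨ cong₂ _+_ (cong cap (take-∪ n S T))
                   (cong₂ _+_ (cong r (take-∩ n S T)) (cong ∣_∣ (drop-∩ n S T))) ⟩
    cap (A₁ ∪ A₂) + (r (A₁ ∩ A₂) + ∣ B₁ ∩ B₂ ∣)
      ≡⟨ +-assoc (cap (A₁ ∪ A₂)) _ _ ⟨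
    (cap (A₁ ∪ A₂) + r (A₁ ∩ A₂)) + ∣ B₁ ∩ B₂ ∣
      ≤⟨ +-mono-≤ (cap-mixed A₁ A₂) (∣p∩q∣≤∣p∣ B₁ B₂) ⟩
    (r A₁ + cap A₂) + ∣ B₁ ∣
      ≡⟨ xy∙z≈xz∙y (r A₁) _ _ ⟩
    free S + capped T
      ∎
    where
    open ≤-Reasoning
    A₁ = take n S
    A₂ = take n T
    B₁ = drop n S
    B₂ = drop n T

  matroid : Matroid (n + k)
  matroid = record
    { rk         = free ⊓ᶠ capped
    ; rk-bounded = λ S → ≤-trans (m⊓n≤m _ _)
        (≤-trans (+-monoˡ-≤ _ (rk-bounded M (take n S))) (≤-reflexive (∣take∣+∣drop∣ n S)))
    ; rk-mono    = λ S T S⊆T → ⊓-mono-≤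
        (+-mono-≤ (r-mono (take-⊆ n S⊆T)) (p⊆q⇒∣p∣≤∣q∣ (drop-⊆ n S⊆T))) (cap-mono (take-⊆ n S⊆T))
    ; rk-submod  = ⊓-submodular {f = free} {g = capped} free-submod capped-submod free-capped-mixed
    }

  rank-++ : ∀ (A : Subset n) (B : Subset k) → rk matroid (A ++ B) ≡ (r A + ∣ B ∣) ⊓ cap A
  rank-++ A B = cong₂ (λ A′ B′ → (r A′ + ∣ B′ ∣) ⊓ cap A′) (take-++ A B) (drop-++ A B)

  isExtension : IsExtension M matroid
  isExtension A = begin
    rk matroid (A ++ ⊥)      ≡⟨ rank-++ A ⊥ ⟩
    (r A + ∣ ⊥ {k} ∣) ⊓ cap A ≡⟨ cong (λ t → (r A + t) ⊓ cap A) (∣⊥∣≡0 k) ⟩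
    (r A + 0) ⊓ cap A        ≡⟨ cong (_⊓ cap A) (+-identityʳ (r A)) ⟩
    r A ⊓ cap A              ≡⟨ m≤n⇒m⊓n≡m (rk≤cap A) ⟩
    r A                      ∎
    where open ≡-Reasoning

  rank-embQ-∪-setZ : ∀ A → rk matroid (embQ k A ∪ setZ n k) ≡ (r A + k) ⊓ cap A
  rank-embQ-∪-setZ A = trans (cong (rk matroid) (embQ-∪-setZ k A))
    (trans (rank-++ A ⊤) (cong (λ t → (r A + t) ⊓ cap A) (∣⊤∣≡n k)))

  rank-setZ : rk matroid (setZ n k) ≡ k ⊓ cap ⊥
  rank-setZ = trans (rank-++ ⊥ ⊤) (cong₂ (λ x t → (x + t) ⊓ cap ⊥) r-⊥ (∣⊤∣≡n k))

  capExtension-isAK : ∀ {X Y} → IsFlat M X → cap X ≤ r X →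
    (∀ F → F ⊆ X → IsFlat M F → (r F + k) ⊓ cap F + r Y ≡ r (F ∪ Y) + k) →
    IsAK M matroid X Y
  capExtension-isAK {X} {Y} flatX capX≤rX onFlats = isExtension , ak₁ , ak₂
    where
    module E = RankProperties matroid
    Z : Subset (n + k)
    Z = setZ n k
    e : Subset n → Subset (n + k)
    e = embQ k

    onSubsets : ∀ A → A ⊆ X → (r A + k) ⊓ cap A + r Y ≡ r (A ∪ Y) + k
    onSubsets A A⊆X = begin
      (r A + k) ⊓ cap A + r Y            ≡⟨ cong₂ (λ x y → (x + k) ⊓ y + r Y) r-cl (cap-cl H) ⟨
      (r (cl A) + k) ⊓ cap (cl A) + r Y  ≡⟨ onFlats (cl A) (cl-least flatX A⊆X) cl-isFlat ⟩
      r (cl A ∪ Y) + k                   ≡⟨ cong (_+ k) r-cl-∪ ⟩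
      r (A ∪ Y) + k                      ∎
      where open ≡-Reasoning

    -- r(Z) = k needs no hypothesis of its own: it is the instance F = cl ⊥ of onFlats.
    rank-Z≡k : rk matroid Z ≡ k
    rank-Z≡k = trans rank-setZ (+-cancelʳ-≡ (r Y) _ _ (begin
      k ⊓ cap ⊥ + r Y            ≡⟨ cong (λ x → (x + k) ⊓ cap ⊥ + r Y) r-⊥ ⟨
      (r ⊥ + k) ⊓ cap ⊥ + r Y    ≡⟨ onSubsets ⊥ (⊆-min X) ⟩
      r (⊥ ∪ Y) + k              ≡⟨ cong (λ S → r S + k) (∪-identityˡ Y) ⟩
      r Y + k                    ≡⟨ +-comm (r Y) k ⟩
      k + r Y                    ∎))
      where open ≡-Reasoning

    ak₁ : condRk matroid Z (e X) ≡ 0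
    ak₁ = Equivalence.from E.condRk≡0⇔ (begin
      rk matroid (Z ∪ e X)  ≡⟨ E.r-∪-comm ⟩
      rk matroid (e X ∪ Z)  ≡⟨ rank-embQ-∪-setZ X ⟩
      (r X + k) ⊓ cap X     ≤⟨ m⊓n≤n _ _ ⟩
      cap X                 ≤⟨ capX≤rX ⟩
      r X                   ≡⟨ isExtension X ⟨
      rk matroid (e X)      ∎)
      where open ≤-Reasoning

    ak₂ : ∀ X′ → X′ ⊆ X → condRk matroid (e X′) Z ≡ condRk matroid (e X′) (e Y)
    ak₂ X′ X′⊆X = Equivalence.from E.condRk-cong⇔ (begin
      rk matroid (e X′ ∪ Z) + rk matroid (e Y)  ≡⟨ cong₂ _+_ (rank-embQ-∪-setZ X′) (isExtension Y) ⟩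
      (r X′ + k) ⊓ cap X′ + r Y                 ≡⟨ onSubsets X′ X′⊆X ⟩
      r (X′ ∪ Y) + k
        ≡⟨ cong₂ _+_ (rk-embQ-∪ {M = M} matroid isExtension X′ Y) rank-Z≡k ⟨
      rk matroid (e X′ ∪ e Y) + rk matroid Z    ∎)
      where open ≡-Reasoning

capExtension : ∀ {n} {M : Matroid n} → Cap M → (k : ℕ) → Matroid (n + k)
capExtension = CapExtension.matroid

open CapExtension using (capExtension-isAK)

-- p = r(X′Z), f = r(X′), w = r(X′Y), a = r(X), u = r(XY), b = r(Y), z = r(Z).
dl-arith : ∀ {p f w a u b z} → p + b ≡ w + z → a + b ≡ u + z → f ≤ p → (p ≤ f ⇔ w + a ≡ u + f)
dl-arith {p} {f} {w} {a} {u} {b} {z} p+b≡w+z a+b≡u+z f≤p = mk⇔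
  (λ p≤f → trans (sym p+u≡w+a) (trans (cong (_+ u) (≤-antisym p≤f f≤p)) (+-comm f u)))
  (λ w+a≡u+f → ≤-reflexive (+-cancelʳ-≡ u p f (trans p+u≡w+a (trans w+a≡u+f (+-comm u f)))))
  where
  open ≡-Reasoning
  p+u≡w+a : p + u ≡ w + a
  p+u≡w+a = +-cancelʳ-≡ (b + z) _ _ (begin
    (p + u) + (b + z)  ≡⟨ interchange p u b z ⟩
    (p + b) + (u + z)  ≡⟨ cong₂ _+_ p+b≡w+z (sym a+b≡u+z) ⟩
    (w + z) + (a + b)  ≡⟨ interchange w z a b ⟩
    (w + a) + (z + b)  ≡⟨ cong ((w + a) +_) (+-comm z b) ⟩
    (w + a) + (b + z)  ∎)

AK⇒DL : ∀ {n m} {M : Matroid n} {g : Matroid (n + m)} {X Y : Subset n} →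
        IsAK M g X Y → IsDL M g X Y
AK⇒DL {n} {m} {M} {g} {X} {Y} (ext , ak₁ , ak₂) = ext , cl Z , cl-isFlat , dl₁ , dl₂
  where
  open RankProperties g
  Z : Subset (n + m)
  Z = setZ n m
  e : Subset n → Subset (n + m)
  e = embQ m

  dl₁ : condRk g (cl Z) (e X) ≡ 0
  dl₁ = trans (cong (_∸ r (e X)) r-cl-∪) ak₁

  ak₂′ : ∀ A → A ⊆ X → r (e A ∪ Z) + r (e Y) ≡ r (e A ∪ e Y) + r Z
  ak₂′ A A⊆X = Equivalence.to condRk-cong⇔ (ak₂ A A⊆X)

  r-eX∪Z : r (e X ∪ Z) ≡ r (e X)
  r-eX∪Z = ≤-antisym (≤-trans (≤-reflexive r-∪-comm) (Equivalence.to condRk≡0⇔ ak₁)) (r-mono ⊆-∪ˡ)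

  dl₂ : ∀ X′ → X′ ⊆ X → IsFlat M X′ →
        (condRk g (cl Z) (e X′) ≡ 0) ⇔ (condRk g (e Y) (e X′) ≡ condRk g (e Y) (e X))
  dl₂ X′ X′⊆X _ = begin
    condRk g (cl Z) (e X′) ≡ 0
      ≈⟨ condRk≡0⇔ ⟩
    r (cl Z ∪ e X′) ≤ r (e X′)
      ≡⟨ cong (_≤ r (e X′)) (trans r-cl-∪ r-∪-comm) ⟩
    r (e X′ ∪ Z) ≤ r (e X′)
      ≈⟨ dl-arith (ak₂′ X′ X′⊆X) (trans (cong (_+ r (e Y)) (sym r-eX∪Z)) (ak₂′ X ⊆-refl)) (r-mono ⊆-∪ˡ) ⟩
    r (e X′ ∪ e Y) + r (e X) ≡ r (e X ∪ e Y) + r (e X′)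
      ≡⟨ cong₂ (λ w u → w + r (e X) ≡ u + r (e X′)) r-∪-comm r-∪-comm ⟩
    r (e Y ∪ e X′) + r (e X) ≡ r (e Y ∪ e X) + r (e X′)
      ≈⟨ ⇔.sym condRk-cong⇔ ⟩
    condRk g (e Y) (e X′) ≡ condRk g (e Y) (e X)
      ∎
    where open ⇔-Reasoning

-- f = r(F), s = r(F ∪ T), w = r(FY), a = r(X), b = r(Y), u = r(XY).  Submodularity leaves
-- w - f ∈ {u - a, b} = {b - 1, b}, and (DL2) says which of the two occurs.
gapOne-arith : ∀ {f s w a b u} → f ≤ s → w ≤ f + b → u + f ≤ a + w → a + b ≡ u + 1 →
               (s ≤ f ⇔ w + a ≡ u + f) → (f + 1) ⊓ s + b ≡ w + 1
gapOne-arith {f} {s} {w} {a} {b} {u} f≤s w≤f+b u+f≤a+w a+b≡u+1 dl =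
  [ tight-case , loose-case ]′ (m≤n⇒m<n∨m≡n w≤f+b)
  where
  shift : (w + a) + b ≡ u + (w + 1)
  shift = begin
    (w + a) + b  ≡⟨ +-assoc w a b ⟩
    w + (a + b)  ≡⟨ cong (w +_) a+b≡u+1 ⟩
    w + (u + 1)  ≡⟨ x∙yz≈y∙xz w u 1 ⟩
    u + (w + 1)  ∎
    where open ≡-Reasoning

  dl-gap : w + a ≡ u + f ⇔ w + 1 ≡ f + b
  dl-gap = mk⇔
    (λ eq → +-cancelˡ-≡ u _ _ (trans (sym shift) (trans (cong (_+ b) eq) (+-assoc u f b))))
    (λ eq → +-cancelʳ-≡ b _ _ (trans shift (trans (cong (u +_) eq) (sym (+-assoc u f b)))))

  f+b≤w+1 : f + b ≤ w + 1
  f+b≤w+1 = +-cancelˡ-≤ u _ _ (begin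
    u + (f + b)  ≡⟨ +-assoc u f b ⟨
    (u + f) + b  ≤⟨ +-monoˡ-≤ b u+f≤a+w ⟩
    (a + w) + b  ≡⟨ cong (_+ b) (+-comm a w) ⟩
    (w + a) + b  ≡⟨ shift ⟩
    u + (w + 1)  ∎)
    where open ≤-Reasoning

  tight-case : w < f + b → (f + 1) ⊓ s + b ≡ w + 1
  tight-case w<f+b = begin
    (f + 1) ⊓ s + b  ≡⟨ cong (λ t → (f + 1) ⊓ t + b) s≡f ⟩
    (f + 1) ⊓ f + b  ≡⟨ cong (_+ b) (m≥n⇒m⊓n≡n (m≤m+n f 1)) ⟩
    f + b            ≡⟨ w+1≡f+b ⟨
    w + 1            ∎
    where
    open ≡-Reasoning
    w+1≡f+b : w + 1 ≡ f + b
    w+1≡f+b = ≤-antisym (subst (_≤ f + b) (+-comm 1 w) w<f+b) f+b≤w+1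
    s≡f : s ≡ f
    s≡f = ≤-antisym (Equivalence.from dl (Equivalence.from dl-gap w+1≡f+b)) f≤s

  loose-case : w ≡ f + b → (f + 1) ⊓ s + b ≡ w + 1
  loose-case w≡f+b = begin
    (f + 1) ⊓ s + b  ≡⟨ cong (_+ b) (m≤n⇒m⊓n≡m f+1≤s) ⟩
    (f + 1) + b      ≡⟨ xy∙z≈xz∙y f 1 b ⟩
    (f + b) + 1      ≡⟨ cong (_+ 1) w≡f+b ⟨
    w + 1            ∎
    where
    open ≡-Reasoning
    s≰f : ¬ s ≤ f
    s≰f s≤f = m+1+n≢m w (trans (Equivalence.to dl-gap (Equivalence.to dl s≤f)) (sym w≡f+b))
    f+1≤s : f + 1 ≤ s
    f+1≤s = subst (_≤ s) (+-comm 1 f) (≰⇒> s≰f)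

gapOne-hasAK : ∀ {n} {M : Matroid n} {X Y : Subset n} → IsFlat M X →
               rk M X + rk M Y ≡ rk M (X ∪ Y) + 1 → HasDL M X Y → HasMatroidAK M X Y
gapOne-hasAK {n} {M} {X} {Y} flatX gap (m , g , ext , T , _ , dl₁ , dl₂) =
  1 , capExtension H 1 , capExtension-isAK H 1 flatX capX≤rX onFlats
  where
  open RankProperties M
  module G = RankProperties g
  e : Subset n → Subset (n + m)
  e = embQ m
  H : Cap M
  H = extensionCap g ext T

  capX≤rX : rk g (e X ∪ T) ≤ r X
  capX≤rX = begin
    rk g (e X ∪ T)  ≡⟨ G.r-∪-comm ⟩
    rk g (T ∪ e X)  ≤⟨ Equivalence.to G.condRk≡0⇔ dl₁ ⟩
    rk g (e X)      ≡⟨ ext X ⟩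
    r X             ∎
    where open ≤-Reasoning

  dl-on : ∀ F → F ⊆ X → IsFlat M F →
          rk g (e F ∪ T) ≤ r F ⇔ r (F ∪ Y) + r X ≡ r (X ∪ Y) + r F
  dl-on F F⊆X flatF = begin
    rk g (e F ∪ T) ≤ r F
      ≡⟨ cong₂ _≤_ G.r-∪-comm (sym (ext F)) ⟩
    rk g (T ∪ e F) ≤ rk g (e F)
      ≈⟨ ⇔.sym G.condRk≡0⇔ ⟩
    condRk g T (e F) ≡ 0
      ≈⟨ dl₂ F F⊆X flatF ⟩
    condRk g (e Y) (e F) ≡ condRk g (e Y) (e X)
      ≈⟨ G.condRk-cong⇔ ⟩
    rk g (e Y ∪ e F) + rk g (e X) ≡ rk g (e Y ∪ e X) + rk g (e F)
      ≡⟨ cong₂ _≡_ (cong₂ _+_ (trans (rk-embQ-∪ {M = M} g ext Y F) r-∪-comm) (ext X))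
                   (cong₂ _+_ (trans (rk-embQ-∪ {M = M} g ext Y X) r-∪-comm) (ext F)) ⟩
    r (F ∪ Y) + r X ≡ r (X ∪ Y) + r F
      ∎
    where open ⇔-Reasoning

  onFlats : ∀ F → F ⊆ X → IsFlat M F → (r F + 1) ⊓ rk g (e F ∪ T) + r Y ≡ r (F ∪ Y) + 1
  onFlats F F⊆X flatF = gapOne-arith (Cap.rk≤cap H F) r-subadditive
    (r-submod-⊆ F⊆X ⊆-∪ˡ (∪-mono-⊆ ⊆-refl ⊆-∪ʳ)) gap (dl-on F F⊆X flatF)

module TwoPlanes {n : ℕ} {M : Matroid n} {X Y : Subset n} (r⊤≡4 : rk M ⊤ ≡ 4) (flatY : IsFlat M Y)
                 (rX≡3 : rk M X ≡ 3) (rY≡3 : rk M Y ≡ 3) (rX∩Y≤1 : rk M (X ∩ Y) ≤ 1) where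
  open RankProperties M

  P : Subset n
  P = X ∩ Y

  c : ℕ
  c = 2 ∸ r P

  rP+c≡2 : r P + c ≡ 2
  rP+c≡2 = m+[n∸m]≡n (≤-trans rX∩Y≤1 (n≤1+n 1))

  -- The two new points span a line of the plane X through the point (or empty set) X ∩ Y,
  -- in general position otherwise.
  H : Cap M
  H = Cap-⊓ (rk-∪-cap P c) (rk-∪-cap X 0) (r-∪-shift-mixed ∩-⊆ˡ)

  capX≤rX : Cap.cap H X ≤ r X
  capX≤rX = ≤-trans (m⊓n≤n _ _) (≤-reflexive (trans (+-identityʳ _) (cong r (∪-idem X))))

  module _ (F : Subset n) (F⊆X : F ⊆ X) where

    rFZ : ℕ
    rFZ = (r F + 2) ⊓ Cap.cap H F

    r[F∪X]+0≡3 : r (F ∪ X) + 0 ≡ 3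
    r[F∪X]+0≡3 = trans (+-identityʳ _)
      (trans (≤-antisym (r-mono (∪-least F⊆X ⊆-refl)) (r-mono ⊆-∪ʳ)) rX≡3)

    rFZ≤3 : rFZ ≤ 3
    rFZ≤3 = ≤-trans (m⊓n≤n _ _) (≤-trans (m⊓n≤n _ _) (≤-reflexive r[F∪X]+0≡3))

    ≤rFZ : ∀ {t} → t ≤ r F + 2 → t ≤ r (F ∪ P) + c → t ≤ 3 → t ≤ rFZ
    ≤rFZ t≤rF+2 t≤rFP+c t≤3 =
      ⊓-glb t≤rF+2 (⊓-glb t≤rFP+c (≤-trans t≤3 (≤-reflexive (sym r[F∪X]+0≡3))))

    F⊆Y⇒rFZ≡2 : F ⊆ Y → rFZ ≡ 2
    F⊆Y⇒rFZ≡2 F⊆Y = ≤-antisym (begin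
      rFZ            ≤⟨ ≤-trans (m⊓n≤n _ _) (m⊓n≤m _ _) ⟩
      r (F ∪ P) + c  ≤⟨ +-monoˡ-≤ c (r-mono (∪-least (∩-greatest F⊆X F⊆Y) ⊆-refl)) ⟩
      r P + c        ≡⟨ rP+c≡2 ⟩
      2              ∎)
      (≤rFZ (m≤n+m 2 _) (≤-trans (≤-reflexive (sym rP+c≡2)) (+-monoˡ-≤ c (r-mono ⊆-∪ʳ))) (n≤1+n 2))
      where open ≤-Reasoning

    rY<rFY⇒rFZ≡3 : r Y < r (F ∪ Y) → rFZ ≡ 3
    rY<rFY⇒rFZ≡3 rY<rFY = ≤-antisym rFZ≤3 (≤rFZ 3≤rF+2 3≤rFP+c ≤-refl)
      where
      open ≤-Reasoning
      3≤rF+2 : 3 ≤ r F + 2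
      3≤rF+2 = +-monoˡ-≤ 2 (+-cancelʳ-< (r Y) 0 (r F) (<-≤-trans rY<rFY r-subadditive))
      rP<rFP : r P < r (F ∪ P)
      rP<rFP = ≰⇒> λ rFP≤rP → <⇒≱ rY<rFY (begin
        r (F ∪ Y)        ≤⟨ r-mono (∪-mono-⊆ ⊆-∪ˡ ⊆-refl) ⟩
        r ((F ∪ P) ∪ Y)  ≤⟨ r-∪-spanned ⊆-∪ʳ rFP≤rP ⟩
        r (P ∪ Y)        ≤⟨ r-mono (∪-least ∩-⊆ʳ ⊆-refl) ⟩
        r Y              ∎)
      3≤rFP+c : 3 ≤ r (F ∪ P) + c
      3≤rFP+c = ≤-trans (≤-reflexive (cong suc (sym rP+c≡2))) (+-monoˡ-≤ c rP<rFP)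

  onFlats : ∀ F → F ⊆ X → IsFlat M F → (r F + 2) ⊓ Cap.cap H F + r Y ≡ r (F ∪ Y) + 2
  onFlats F F⊆X _ with r (F ∪ Y) ≤? r Y
  ... | yes rFY≤rY = begin
    rFZ F F⊆X + r Y  ≡⟨ cong₂ _+_ (F⊆Y⇒rFZ≡2 F F⊆X F⊆Y) rY≡3 ⟩
    2 + 3            ≡⟨ cong (_+ 2) (trans (≤-antisym rFY≤rY (r-mono ⊆-∪ʳ)) rY≡3) ⟨
    r (F ∪ Y) + 2    ∎
    where
    open ≡-Reasoning
    F⊆Y : F ⊆ Y
    F⊆Y = flat-⊇ flatY (≤-trans (≤-reflexive r-∪-comm) rFY≤rY)
  ... | no rFY≰rY = begin
    rFZ F F⊆X + r Y  ≡⟨ cong₂ _+_ (rY<rFY⇒rFZ≡3 F F⊆X rY<rFY) rY≡3 ⟩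
    3 + 3            ≡⟨ cong (_+ 2) rFY≡4 ⟨
    r (F ∪ Y) + 2    ∎
    where
    open ≡-Reasoning
    rY<rFY : r Y < r (F ∪ Y)
    rY<rFY = ≰⇒> rFY≰rY
    rFY≡4 : r (F ∪ Y) ≡ 4
    rFY≡4 = ≤-antisym (≤-trans (r-mono ⊆⊤) (≤-reflexive r⊤≡4)) (subst (_< r (F ∪ Y)) rY≡3 rY<rFY)

  twoPlanes-hasAK : IsFlat M X → HasMatroidAK M X Y
  twoPlanes-hasAK flatX = 2 , capExtension H 2 , capExtension-isAK H 2 flatX capX≤rX onFlats

open TwoPlanes using (twoPlanes-hasAK)

rankFour-cases : ∀ {a b u i} → u ≤ 4 → a < u → b < u → u + i < a + b →
                 a + b ≡ u + 1 ⊎ (a ≡ 3 × b ≡ 3 × i ≤ 1)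
rankFour-cases {a} {b} {u} {i} u≤4 a<u b<u u+i<a+b with a + b ≟ u + 1
... | yes gap = inj₁ gap
... | no ¬gap = inj₂ (a≡3 , b≡3 , i≤1)
  where
  u+2≤a+b : u + 2 ≤ a + b
  u+2≤a+b = subst (_≤ a + b) (sym (+-suc u 1)) (≤∧≢⇒< u+1≤a+b (¬gap ∘ sym))
    where
    u+1≤a+b : u + 1 ≤ a + b
    u+1≤a+b = ≤-trans (≤-reflexive (+-comm u 1)) (≤-trans (s≤s (m≤m+n u i)) u+i<a+b)
  a≡3 : a ≡ 3
  a≡3 = ≤-antisym (≤-pred (≤-trans a<u u≤4))
    (+-cancelʳ-≤ b 3 a
      (≤-trans (≤-reflexive (cong suc (+-comm 2 b))) (≤-trans (+-monoˡ-≤ 2 b<u) u+2≤a+b)))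
  b≡3 : b ≡ 3
  b≡3 = ≤-antisym (≤-pred (≤-trans b<u u≤4))
    (+-cancelˡ-≤ a 3 b (≤-trans (≤-reflexive (+-suc a 2)) (≤-trans (+-monoˡ-≤ 2 a<u) u+2≤a+b)))
  i≤1 : i ≤ 1
  i≤1 = +-cancelˡ-≤ 4 i 1 (≤-pred (≤-trans (s≤s (+-monoˡ-≤ i (subst (_< u) a≡3 a<u)))
          (≤-trans u+i<a+b (≤-reflexive (cong₂ _+_ a≡3 b≡3)))))

proposition5p12 : ∀ {n} (M : Matroid n) (X Y : Subset n) →
    rk M ⊤ ≡ 4 → IsFlat M X → IsFlat M Y → NonModular M X Y →
    HasDL M X Y ⇔ HasMatroidAK M X Y
proposition5p12 M X Y r⊤≡4 flatX flatY nonmodular =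
  mk⇔ DL⇒AK (λ (m , g , isAK) → m , g , AK⇒DL {M = M} {g = g} isAK)
  where
  open RankProperties M
  cases : r X + r Y ≡ r (X ∪ Y) + 1 ⊎ (r X ≡ 3 × r Y ≡ 3 × r (X ∩ Y) ≤ 1)
  cases = rankFour-cases (≤-trans (r-mono ⊆⊤) (≤-reflexive r⊤≡4))
    (flat-<-∪ flatX (nonmodular ∘ ⊆⇒Modular))
    (subst (r Y <_) r-∪-comm (flat-<-∪ flatY (nonmodular ∘ ⊇⇒Modular)))
    (NonModular⇒< nonmodular)

  DL⇒AK : HasDL M X Y → HasMatroidAK M X Y
  DL⇒AK dl = [ (λ gap → gapOne-hasAK {M = M} flatX gap dl)
             , (λ (rX≡3 , rY≡3 , rX∩Y≤1) →
                  twoPlanes-hasAK {M = M} r⊤≡4 flatY rX≡3 rY≡3 rX∩Y≤1 flatX)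
             ]′ cases
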